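{- For every $0<\eta<1$ there exists $\tau_0>0$ such that for every $0<\tau\le\tau_0$ there exists $n_0$ such that the following holds. Let $G$ be a digraph on $n\ge n_0$ vertices whose outdegree sequence $d^+_1\le\dots\le d^+_n$ and indegree sequence $d^-_1\le\dots\le d^-_n$ satisfy, for all $i<n/2$: (i) $d^+_i\ge i+\eta n$ or $d^-_{n-i-\eta n}\ge n-i$, and (ii) $d^-_i\ge i+\eta n$ or $d^+_{n-i-\eta n}\ge n-i$. Then $\delta^0(G)\ge \eta n$ and $G$ is a robust $(\tau^2,\tau)$-outexpander.
   Context: Digraphs have no loops and at most one edge in each direction between any pair of vertices. The out- and indegree sequences are sorted separately. $\delta^0(G)$ is the minimum of the minimum outdegree and the minimum indegree of $G$. For $0<\nu\le\tau<1$ and $S\subseteq V(G)$, the $\nu$-robust outneighbourhood $RN^+_{\nu,G}(S)$ is the set of vertices of $G$ having at least $\nu|G|$ inneighbours in $S$. $G$ is a robust $(\nu,\tau)$-outexpander if $|RN^+_{\nu,G}(S)|\ge |S|+\nu|G|$ for all $S\subseteq V(G)$ with $\tau|G|<|S|<(1-\tau)|G|$.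
   Formalization: The parameters η and τ range over the rationals. -}

module Defs where

open import Data.Bool using (Bool; true; false; _∧_)
open import Data.Nat using (ℕ; zero; suc; _∸_; _⊓_)
open import Data.Nat.Properties using (≤-decTotalOrder)
open import Data.Fin using (Fin)
open import Data.Fin.Subset using (Subset; _∈_)
import Data.Fin.Subset as Sub
open import Data.Vec using (tabulate; lookup)
open import Data.List using (List; []; _∷_; map; allFin)
open import Data.List.Sort ≤-decTotalOrder using (sort)
open import Data.Rational using (ℚ; _≤_; _*_) renaming (_≤?_ to _≤ℚ?_)
import Data.Rational as ℚ
open import Relation.Binary.PropositionalEquality using (_≡_)
open import Relation.Nullary using (does)
open import Data.Product using (_×_)
open import Data.Sum using (_⊎_)
import Data.Integer
import Data.Nat

-- A digraph on the vertex set Fin n: adjacency relation u → v given by a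
-- Boolean matrix, with no loops.  (At most one edge in each direction
-- between two vertices is automatic for a relation.)
record Digraph (n : ℕ) : Set where
  field
    adj    : Fin n → Fin n → Bool
    noLoop : ∀ v → adj v v ≡ false
open Digraph public

count : ∀ {n} → (Fin n → Bool) → ℕ
count f = Sub.∣ tabulate f ∣

outdeg : ∀ {n} → Digraph n → Fin n → ℕ
outdeg G u = count (λ v → adj G u v)

indeg : ∀ {n} → Digraph n → Fin n → ℕ
indeg G v = count (λ u → adj G u v)

-- 0-based list lookup with default 0 (only used in range)
nth : List ℕ → ℕ → ℕ
nth []       _       = 0
nth (x ∷ xs) zero    = x
nth (x ∷ xs) (suc k) = nth xs k

-- sorted (nondecreasing) out-/indegree sequences, 1-indexed:
-- d⁺ G i = d⁺_i, for 1 ≤ i ≤ n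
d⁺ : ∀ {n} → Digraph n → ℕ → ℕ
d⁺ {n} G i = nth (sort (map (outdeg G) (allFin n))) (i ∸ 1)

d⁻ : ∀ {n} → Digraph n → ℕ → ℕ
d⁻ {n} G i = nth (sort (map (indeg G) (allFin n))) (i ∸ 1)

-- minimum semidegree δ⁰(G) = min(min outdegree, min indegree)
-- (taken to be 0 for the empty digraph)
δ⁰ : ∀ {n} → Digraph n → ℕ
δ⁰ G = d⁺ G 1 ⊓ d⁻ G 1

ℕtoℚ : ℕ → ℚ
ℕtoℚ k = (Data.Integer.+ k) ℚ./ 1

inNbrsIn : ∀ {n} → Digraph n → Subset n → Fin n → ℕ
inNbrsIn G S v = count (λ u → lookup S u ∧ adj G u v)

RN⁺ : ∀ {n} → ℚ → Digraph n → Subset n → Subset n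
RN⁺ {n} ν G S = tabulate (λ v → does (ν * ℕtoℚ n ≤ℚ? ℕtoℚ (inNbrsIn G S v)))

RobustOutexpander : ∀ {n} → ℚ → ℚ → Digraph n → Set
RobustOutexpander {n} ν τ G =
  (S : Subset n) →
  τ * ℕtoℚ n ℚ.< ℕtoℚ Sub.∣ S ∣ →
  ℕtoℚ Sub.∣ S ∣ ℚ.< (ℚ.1ℚ ℚ.- τ) * ℕtoℚ n →
  ℕtoℚ Sub.∣ S ∣ ℚ.+ ν * ℕtoℚ n ≤ ℕtoℚ Sub.∣ RN⁺ ν G S ∣

shiftIdx : ℕ → ℚ → ℕ → Data.Integer.ℤ
shiftIdx n η i = ℚ.floor (ℕtoℚ n ℚ.- ℕtoℚ i ℚ.- η * ℕtoℚ n)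

-- "d_k ≥ n - i" where k = n - i - ηn must be a genuine index (k ≥ 1)
ShiftedDeg≥ : (ℕ → ℕ) → ℕ → ℚ → ℕ → Set
ShiftedDeg≥ d n η i =
  (Data.Integer.+ 1 Data.Integer.≤ shiftIdx n η i) ×
  (n ∸ i Data.Nat.≤ d Data.Integer.∣ shiftIdx n η i ∣)

DegSeqCond : ∀ {n} → ℚ → Digraph n → Set
DegSeqCond {n} η G =
  (i : ℕ) → 1 Data.Nat.≤ i → 2 Data.Nat.* i Data.Nat.< n →
  ((ℕtoℚ i ℚ.+ η * ℕtoℚ n ≤ ℕtoℚ (d⁺ G i)) ⊎ ShiftedDeg≥ (d⁻ G) n η i) ×
  ((ℕtoℚ i ℚ.+ η * ℕtoℚ n ≤ ℕtoℚ (d⁻ G i)) ⊎ ShiftedDeg≥ (d⁺ G) n η i)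

module Submission where

-- Let τ ≤ η/4 and let n be large enough that τn ≥ 1.  The proof works with
-- the integers e = ⌊ηn⌋, t = ⌊τn⌋ and x = ⌊τ²n⌋, which satisfy t ≥ 1,
-- 2x < t, 4t ≤ e and nx < (t + 1)².
--
-- Condition (i) for i = 1 gives either d⁺₁ ≥ 1 + ηn, or
-- at least ηn + 2 vertices of indegree n - 1; every vertex sends an edge to
-- all of these except possibly itself, so again δ⁺ ≥ e + 1 > ηn.  The same
-- argument in the reversed digraph bounds δ⁻.
--
-- Let t < |S| < n - t, let R be the set of vertices with
-- more than x inneighbours in S and suppose |R| ≤ |S| + x.  Double counting
-- shows that at most nx edges go from S to vertices outside R.  If
-- 2(|S| - t) < n, condition (i) for i = |S| - t fails: by Markov's inequality
-- at least i vertices of S have outdegree below i + e, and every vertex of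
-- indegree at least n - i has t > x inneighbours in S, so there are too few of
-- them.  Otherwise condition (ii) for i = n - |S| - t fails: at least i
-- vertices lie outside R and have indegree below i + e, while the at least
-- e + 1 - t vertices of S of outdegree at least n - i each send t - x edges
-- outside R, more than nx in total.

module Counting where

  open import Data.Bool using (Bool; true; false; _∧_; not; T)
  open import Data.Empty using (⊥-elim)
  open import Data.Fin using (Fin; zero; suc) renaming (_≟_ to _≟ᶠ_)
  open import Data.Fin.Subset using (Subset)
  import Data.Fin.Subset as Sub
  open import Data.Nat
  open import Data.Nat.Properties
  open import Algebra.Properties.CommutativeMonoid.Sum +-0-commutativeMonoid
    using (sum; sum-cong-≗; ∑-comm)
  open import Data.Unit using (tt)
  open import Data.Vec using (_∷_; []; lookup)
  open import Function using (_∘_)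
  open import Relation.Binary.PropositionalEquality
  open import Relation.Nullary using (¬_; Dec; does; yes; no)
  open import Defs using (count)

  𝟙 : Bool → ℕ
  𝟙 true  = 1
  𝟙 false = 0

  does⇒ : ∀ {A : Set} (a? : Dec A) → T (does a?) → A
  does⇒ (yes a) _ = a

  ⇒does : ∀ {A : Set} (a? : Dec A) → A → T (does a?)
  ⇒does (yes _) _ = tt
  ⇒does (no ¬a) a = ¬a a

  not-does⇒ : ∀ {A : Set} (a? : Dec A) → T (not (does a?)) → ¬ A
  not-does⇒ (no ¬a) _ = ¬a

  ⇒not-does : ∀ {A : Set} (a? : Dec A) → ¬ A → T (not (does a?))
  ⇒not-does (yes a) ¬a = ¬a a
  ⇒not-does (no _)  _  = tt

  ∧-intro : ∀ a b → T a → T b → T (a ∧ b)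
  ∧-intro true true _ q = q

  ∧-fst : ∀ a b → T (a ∧ b) → T a
  ∧-fst true _ _ = tt

  ∧-snd : ∀ a b → T (a ∧ b) → T b
  ∧-snd true _ q = q

  # : ∀ {n} → (Fin n → Bool) → ℕ
  # {zero}  P = 0
  # {suc n} P = 𝟙 (P zero) + # (P ∘ suc)

  #-as-sum : ∀ {n} (P : Fin n → Bool) → # P ≡ sum (𝟙 ∘ P)
  #-as-sum {zero}  P = refl
  #-as-sum {suc n} P = cong (𝟙 (P zero) +_) (#-as-sum (P ∘ suc))

  count≡# : ∀ {n} (P : Fin n → Bool) → count P ≡ # P
  count≡# {zero}  P = refl
  count≡# {suc n} P with P zero
  ... | true  = cong suc (count≡# (P ∘ suc))
  ... | false = count≡# (P ∘ suc)

  ∣S∣≡# : ∀ {n} (S : Subset n) → Sub.∣ S ∣ ≡ # (lookup S)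
  ∣S∣≡# []          = refl
  ∣S∣≡# (true ∷ S)  = cong suc (∣S∣≡# S)
  ∣S∣≡# (false ∷ S) = ∣S∣≡# S

  ∑-≤-const : ∀ {n} {f : Fin n → ℕ} c → (∀ v → f v ≤ c) → sum f ≤ n * c
  ∑-≤-const {zero}  c f≤c = z≤n
  ∑-≤-const {suc n} c f≤c = +-mono-≤ (f≤c zero) (∑-≤-const c (f≤c ∘ suc))

  double-counting : ∀ {m n} (M : Fin m → Fin n → Bool) → sum (λ u → # (M u)) ≡ sum (λ v → # (λ u → M u v))
  double-counting M = begin
      sum (λ u → # (M u))                   ≡⟨ sum-cong-≗ (λ u → #-as-sum (M u)) ⟩
      sum (λ u → sum (λ v → 𝟙 (M u v)))     ≡⟨ ∑-comm (λ u v → 𝟙 (M u v)) ⟩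
      sum (λ v → sum (λ u → 𝟙 (M u v)))     ≡⟨ sum-cong-≗ (λ v → #-as-sum (λ u → M u v)) ⟨
      sum (λ v → # (λ u → M u v))           ∎
    where open ≡-Reasoning

  #-mono : ∀ {n} {P Q : Fin n → Bool} → (∀ v → T (P v) → T (Q v)) → # P ≤ # Q
  #-mono {zero}  P⇒Q = z≤n
  #-mono {suc n} P⇒Q = +-mono-≤ (𝟙-mono (P⇒Q zero)) (#-mono (P⇒Q ∘ suc))
    where
      𝟙-mono : ∀ {a b} → (T a → T b) → 𝟙 a ≤ 𝟙 b
      𝟙-mono {false}         _   = z≤n
      𝟙-mono {true}  {true}  _   = ≤-refl
      𝟙-mono {true}  {false} a⇒b = ⊥-elim (a⇒b tt)

  #-none : ∀ {n} {P : Fin n → Bool} → (∀ v → ¬ T (P v)) → # P ≡ 0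
  #-none {zero}          _    = refl
  #-none {suc n} {P} none with P zero in eq
  ... | true  = ⊥-elim (none zero (subst T (sym eq) tt))
  ... | false = #-none (none ∘ suc)

  #-point : ∀ {n} {P : Fin n → Bool} x → T (P x) → 1 ≤ # P
  #-point {P = P} zero    Px with P zero
  ... | true = s≤s z≤n
  #-point {P = P} (suc x) Px = ≤-trans (#-point x Px) (m≤n+m _ (𝟙 (P zero)))

  #-singleton : ∀ {n} (u : Fin n) → # (λ v → does (v ≟ᶠ u)) ≤ 1
  #-singleton {suc n} zero    = ≤-reflexive (cong suc (#-none {n} λ v ()))
  #-singleton {suc n} (suc u) = #-singleton u

  #-split : ∀ {n} (P Q : Fin n → Bool) → # P ≡ # (λ v → P v ∧ Q v) + # (λ v → P v ∧ not (Q v))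
  #-split {zero}  P Q = refl
  #-split {suc n} P Q with P zero | Q zero | #-split (P ∘ suc) (Q ∘ suc)
  ... | true  | true  | split = cong suc split
  ... | true  | false | split = trans (cong suc split) (sym (+-suc _ _))
  ... | false | _     | split = split

  #-compl : ∀ {n} (P : Fin n → Bool) → # P + # (not ∘ P) ≡ n
  #-compl {zero}  P = refl
  #-compl {suc n} P with P zero
  ... | true  = cong suc (#-compl (P ∘ suc))
  ... | false = trans (+-suc _ _) (cong suc (#-compl (P ∘ suc)))

  #-≤-split : ∀ {n} (P Q : Fin n → Bool) → # P ≤ # (λ v → P v ∧ Q v) + # (not ∘ Q)
  #-≤-split P Q = begin
      # P                                                 ≡⟨ #-split P Q ⟩
      # (λ v → P v ∧ Q v) + # (λ v → P v ∧ not (Q v))     ≤⟨ +-monoʳ-≤ (# (λ v → P v ∧ Q v)) (#-mono λ v → drop (P v) (Q v)) ⟩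
      # (λ v → P v ∧ Q v) + # (not ∘ Q)                   ∎
    where
      open ≤-Reasoning
      drop : ∀ a b → T (a ∧ not b) → T (not b)
      drop true false _ = tt

  markov : ∀ {n} (h : Fin n → ℕ) B → # (λ u → does (B ≤? h u)) * B ≤ sum h
  markov {zero}  h B = z≤n
  markov {suc n} h B with B ≤ᵇ h zero in B≤ᵇh₀
  ... | true = +-mono-≤ (≤ᵇ⇒≤ B (h zero) (subst T (sym B≤ᵇh₀) tt)) (markov (h ∘ suc) B)
  ... | false = ≤-trans (markov (h ∘ suc) B) (m≤n+m _ (h zero))

module SortedSequences where

  open import Data.Bool using (true; false)
  open import Data.Fin using (Fin; zero; suc)
  open import Data.List using (List; []; _∷_; map; allFin; tabulate; filter; length)
  open import Data.List.Properties using (map-tabulate; filter-none)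
  open import Data.List.Membership.Propositional.Properties using (∈-map⁻)
  open import Data.List.Relation.Binary.Permutation.Propositional.Properties using (↭-length; filter-↭; ∈-resp-↭)
  open import Data.List.Relation.Unary.All as All using (All; []; _∷_)
  open import Data.List.Relation.Unary.AllPairs using (AllPairs; []; _∷_)
  open import Data.List.Relation.Unary.Any using (here)
  open import Data.List.Relation.Unary.Linked.Properties using (Linked⇒AllPairs)
  open import Data.Nat
  open import Data.Nat.Properties
  open import Data.List.Sort ≤-decTotalOrder using (sort; sort-↭; sort-↗)
  open import Data.Product using (_,_)
  open import Function using (_∘_; id)
  open import Relation.Binary.PropositionalEquality
  open import Relation.Nullary using (does)
  open import Defs using (nth)
  open Counting using (#)

  -- the values of deg listed in nondecreasing order; d⁺/d⁻ of Defs are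
  -- (1-indexed) entries of this list for deg = outdeg/indeg
  sorted : ∀ {n} → (Fin n → ℕ) → List ℕ
  sorted {n} deg = sort (map deg (allFin n))

  below : ℕ → List ℕ → ℕ
  below c ys = length (filter (_<? c) ys)

  below-cons : ∀ c y ys → below c (y ∷ ys) ≤ suc (below c ys)
  below-cons c y ys with does (y <? c)
  ... | true  = ≤-refl
  ... | false = n≤1+n _

  below-nondecreasing : ∀ c {ys} → AllPairs _≤_ ys → ∀ k → c ≤ nth ys k → below c ys ≤ k
  below-nondecreasing c [] k _ = z≤n
  below-nondecreasing c {y ∷ ys} (y≤ys ∷ _) zero c≤y =
    ≤-reflexive (cong length (filter-none (_<? c) (≤⇒≯ c≤y ∷ All.map (λ y≤z → ≤⇒≯ (≤-trans c≤y y≤z)) y≤ys)))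
  below-nondecreasing c {y ∷ ys} (_ ∷ sortedys) (suc k) c≤ =
    ≤-trans (below-cons c y ys) (s≤s (below-nondecreasing c sortedys k c≤))

  below-tabulate : ∀ {n} c (deg : Fin n → ℕ) → below c (tabulate deg) ≡ # (λ v → does (deg v <? c))
  below-tabulate {zero}  c deg = refl
  below-tabulate {suc n} c deg with does (deg zero <? c)
  ... | true  = cong suc (below-tabulate c (deg ∘ suc))
  ... | false = below-tabulate c (deg ∘ suc)

  few-below : ∀ {n} (deg : Fin n → ℕ) k c → c ≤ nth (sorted deg) k → # (λ v → does (deg v <? c)) ≤ k
  few-below {n} deg k c c≤dₖ = begin
    # (λ v → does (deg v <? c))      ≡⟨ sym (below-tabulate c deg) ⟩
    below c (tabulate deg)           ≡⟨ cong (below c) (sym (map-tabulate id deg)) ⟩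
    below c (map deg (allFin n))     ≡⟨ sym (↭-length (filter-↭ (_<? c) (sort-↭ (map deg (allFin n))))) ⟩
    below c (sorted deg)             ≤⟨ below-nondecreasing c (Linked⇒AllPairs ≤-trans (sort-↗ _)) k c≤dₖ ⟩
    k                                ∎
    where open ≤-Reasoning

  -- the smallest entry of the sorted sequence is one of the values of deg
  minimum-≥ : ∀ {n} (deg : Fin n → ℕ) c → 1 ≤ n → (∀ v → c ≤ deg v) → c ≤ nth (sorted deg) 0
  minimum-≥ {suc n} deg c _ c≤deg with sorted deg | sort-↭ (map deg (allFin (suc n)))
  ... | [] | sorted↭ with () ← ↭-length sorted↭
  ... | y ∷ ys | sorted↭ with ∈-map⁻ deg (∈-resp-↭ sorted↭ (here refl))
  ...   | v , _ , y≡deg = subst (c ≤_) (sym y≡deg) (c≤deg v)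

module NaturalsInRationals where

  open import Data.Nat as ℕ using (ℕ; zero; suc; z≤n; s≤s)
  import Data.Nat.Properties as ℕ
  open import Data.Nat.DivMod using (m/n*n≤m; m≡m%n+[m/n]*n; m%n<n)
  import Data.Nat.DivMod as ℕ
  open import Data.Integer as ℤ using (ℤ; +_; -[1+_])
  import Data.Integer.Properties as ℤ
  import Data.Integer.DivMod as ℤ
  open import Data.Integer.GCD using (gcd-zeroʳ)
  open import Data.Nat.Coprimality using (1-coprimeTo)
  import Data.Nat.Coprimality as Coprimality
  open import Data.Rational
  open import Data.Rational.Properties
  open import Data.Product using (Σ; _×_; _,_)
  open import Relation.Binary.PropositionalEquality
  open import Defs using (ℕtoℚ)

  ⟦_⟧ : ℕ → ℚ
  ⟦ k ⟧ = mkℚ (+ k) 0 (Coprimality.sym (1-coprimeTo k))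

  ℕtoℚ-lowest : ∀ k → ℕtoℚ k ≡ ⟦ k ⟧
  ℕtoℚ-lowest k = lowest (ℕtoℚ k) numerator denominator
    where
      numerator : ↥ (ℕtoℚ k) ≡ + k
      numerator = trans (sym (ℤ.*-identityʳ _)) (trans (cong (↥ (ℕtoℚ k) ℤ.*_) (sym (gcd-zeroʳ (+ k)))) (↥-/ (+ k) 1))
      denominator : ↧ (ℕtoℚ k) ≡ + 1
      denominator = trans (sym (ℤ.*-identityʳ _)) (trans (cong (↧ (ℕtoℚ k) ℤ.*_) (sym (gcd-zeroʳ (+ k)))) (↧-/ (+ k) 1))
      lowest : ∀ q → ↥ q ≡ + k → ↧ q ≡ + 1 → q ≡ ⟦ k ⟧
      lowest (mkℚ _ zero _)    refl refl = refl
      lowest (mkℚ _ (suc _) _) _    ()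

  private
    to : ∀ {R : ℚ → ℚ → Set} a b → R ⟦ a ⟧ ⟦ b ⟧ → R (ℕtoℚ a) (ℕtoℚ b)
    to {R} a b = subst₂ R (sym (ℕtoℚ-lowest a)) (sym (ℕtoℚ-lowest b))
    from : ∀ {R : ℚ → ℚ → Set} a b → R (ℕtoℚ a) (ℕtoℚ b) → R ⟦ a ⟧ ⟦ b ⟧
    from {R} a b = subst₂ R (ℕtoℚ-lowest a) (ℕtoℚ-lowest b)
    ·1 : ∀ {R : ℤ → ℤ → Set} a b → R (+ a) (+ b) → R (+ a ℤ.* + 1) (+ b ℤ.* + 1)
    ·1 {R} a b = subst₂ R (sym (ℤ.*-identityʳ (+ a))) (sym (ℤ.*-identityʳ (+ b)))
    ·1⁻¹ : ∀ {R : ℤ → ℤ → Set} a b → R (+ a ℤ.* + 1) (+ b ℤ.* + 1) → R (+ a) (+ b)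
    ·1⁻¹ {R} a b = subst₂ R (ℤ.*-identityʳ (+ a)) (ℤ.*-identityʳ (+ b))

  ℕtoℚ-mono-≤ : ∀ {a b} → a ℕ.≤ b → ℕtoℚ a ≤ ℕtoℚ b
  ℕtoℚ-mono-≤ {a} {b} a≤b = to {_≤_} a b (*≤* (·1 {ℤ._≤_} a b (ℤ.+≤+ a≤b)))

  ℕtoℚ-cancel-≤ : ∀ {a b} → ℕtoℚ a ≤ ℕtoℚ b → a ℕ.≤ b
  ℕtoℚ-cancel-≤ {a} {b} a≤b = ℤ.drop‿+≤+ (·1⁻¹ {ℤ._≤_} a b (drop-*≤* (from {_≤_} a b a≤b)))

  ℕtoℚ-mono-< : ∀ {a b} → a ℕ.< b → ℕtoℚ a < ℕtoℚ b
  ℕtoℚ-mono-< {a} {b} a<b = to {_<_} a b (*<* (·1 {ℤ._<_} a b (ℤ.+<+ a<b)))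

  ℕtoℚ-cancel-< : ∀ {a b} → ℕtoℚ a < ℕtoℚ b → a ℕ.< b
  ℕtoℚ-cancel-< {a} {b} a<b = ℤ.drop‿+<+ (·1⁻¹ {ℤ._<_} a b (drop-*<* (from {_<_} a b a<b)))

  ℕtoℚ-+ : ∀ a b → ℕtoℚ (a ℕ.+ b) ≡ ℕtoℚ a + ℕtoℚ b
  ℕtoℚ-+ a b = sym (to {λ x y → x + y ≡ ℕtoℚ (a ℕ.+ b)} a b
    (cong (_/ 1) (trans (cong₂ ℤ._+_ (ℤ.*-identityʳ (+ a)) (ℤ.*-identityʳ (+ b))) (sym (ℤ.pos-+ a b)))))

  ℕtoℚ-* : ∀ a b → ℕtoℚ (a ℕ.* b) ≡ ℕtoℚ a * ℕtoℚ b
  ℕtoℚ-* a b = sym (to {λ x y → x * y ≡ ℕtoℚ (a ℕ.* b)} a b (cong (_/ 1) (sym (ℤ.pos-* a b))))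

  ℕtoℚ-nonNeg : ∀ k → 0ℚ ≤ ℕtoℚ k
  ℕtoℚ-nonNeg k = ℕtoℚ-mono-≤ {0} {k} z≤n

  floor-ℕ : ∀ q → 0ℚ ≤ q → Σ ℕ λ k → ℕtoℚ k ≤ q × q < ℕtoℚ (suc k)
  floor-ℕ q@(mkℚ (+ a) d _) _ = k ,
      subst (_≤ q) (sym (ℕtoℚ-lowest k))
        (*≤* (subst₂ ℤ._≤_ (ℤ.pos-* k (suc d)) (sym (ℤ.*-identityʳ (+ a))) (ℤ.+≤+ (m/n*n≤m a (suc d))))) ,
      subst (q <_) (sym (ℕtoℚ-lowest (suc k)))
        (*<* (subst₂ ℤ._<_ (sym (ℤ.*-identityʳ (+ a))) (ℤ.pos-* (suc k) (suc d)) (ℤ.+<+ a<[k+1]*d)))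
    where
      k = a ℕ./ suc d
      a<[k+1]*d : a ℕ.< suc k ℕ.* suc d
      a<[k+1]*d = ℕ.≤-<-trans (ℕ.≤-reflexive (m≡m%n+[m/n]*n a (suc d))) (ℕ.+-monoˡ-< (k ℕ.* suc d) (m%n<n a (suc d)))
  floor-ℕ (mkℚ -[1+ _ ] _ _) (*≤* ())

  floor-≤ : ∀ q K → floor q ≡ + K → ℕtoℚ K ≤ q
  floor-≤ q@(mkℚ n d _) K ⌊q⌋≡K = subst (_≤ q) (sym (ℕtoℚ-lowest K))
    (*≤* (subst₂ ℤ._≤_ (cong (ℤ._* ↧ q) ⌊q⌋≡K) (sym (ℤ.*-identityʳ n)) (ℤ.[n/d]*d≤n n (↧ q))))

  ≤-floor : ∀ {m k q} → ℕtoℚ m ≤ q → q < ℕtoℚ (suc k) → m ℕ.≤ k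
  ≤-floor m≤q q<k+1 = ℕ.s≤s⁻¹ (ℕtoℚ-cancel-< (≤-<-trans m≤q q<k+1))

  archimedean : ∀ τ → 0ℚ < τ → ∀ c → Σ ℕ λ n₀ → ∀ n → n₀ ℕ.≤ n → ℕtoℚ c ≤ τ * ℕtoℚ n
  archimedean τ@(mkℚ (+ suc p) d _) _ c = c ℕ.* suc d , λ n n₀≤n →
      to {λ x y → x ≤ τ * y} c n
        (toℚᵘ-cancel-≤ (UP.≤-respʳ-≃ (UP.≃-sym (toℚᵘ-homo-* τ ⟦ n ⟧)) (U.*≤* (cross-bound n n₀≤n))))
    where
      import Data.Rational.Unnormalised as U
      import Data.Rational.Unnormalised.Properties as UP
      cross-bound : ∀ n → c ℕ.* suc d ℕ.≤ n → + c ℤ.* + (suc d ℕ.* 1) ℤ.≤ (+ suc p ℤ.* + n) ℤ.* + 1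
      cross-bound n c[d+1]≤n = subst₂ ℤ._≤_
        (ℤ.pos-* c (suc d ℕ.* 1))
        (trans (ℤ.pos-* (suc p ℕ.* n) 1) (cong (ℤ._* + 1) (ℤ.pos-* (suc p) n)))
        (ℤ.+≤+ (ℕ.≤-trans (ℕ.≤-reflexive (cong (c ℕ.*_) (ℕ.*-identityʳ (suc d))))
               (ℕ.≤-trans c[d+1]≤n (ℕ.≤-trans (ℕ.m≤n*m n (suc p)) (ℕ.≤-reflexive (sym (ℕ.*-identityʳ _)))))))
  archimedean (mkℚ (+ zero) _ _) (*<* (ℤ.+<+ ())) c
  archimedean (mkℚ -[1+ _ ] _ _) (*<* ()) c

module DegreeConditions where

  open import Data.List using (List)
  open import Data.Nat using (ℕ; suc; _+_; _*_; _∸_; _≤_; _<_)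
  open import Data.Product using (Σ; _×_)
  open import Data.Sum using (_⊎_)
  open import Defs using (Digraph; nth; outdeg; indeg)
  open SortedSequences using (sorted)

  -- One alternative of the degree conditions (i)/(ii) for a given i, with ηn
  -- replaced by an integer e: for the sorted sequence ds being bounded and the
  -- other sorted sequence ds' (0-indexed lists, so d_i = nth ds (i ∸ 1)),
  -- either d_i ≥ i + e, or d'_{k+1} ≥ n - i for some k + 1 ≤ n - i - e.
  Alternative : ℕ → ℕ → List ℕ → List ℕ → ℕ → Set
  Alternative n e ds ds' i = (i + e ≤ nth ds (i ∸ 1)) ⊎ (Σ ℕ λ k → suc k + i + e ≤ n × n ∸ i ≤ nth ds' k)

  DegreeCondition : ∀ {n} → ℕ → Digraph n → Set
  DegreeCondition {n} e G = ∀ i → 1 ≤ i → 2 * i < n →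
    Alternative n e (sorted (outdeg G)) (sorted (indeg G)) i × Alternative n e (sorted (indeg G)) (sorted (outdeg G)) i

module MinimumDegree where

  open import Data.Bool using (Bool; true; false; _∧_; not; T)
  open import Data.Empty using (⊥-elim)
  open import Data.Fin using (Fin) renaming (_≟_ to _≟ᶠ_)
  open import Data.Nat
  open import Data.Nat.Properties
  open import Data.Nat.Tactic.RingSolver using (solve-∀)
  open import Data.Product using (_,_)
  open import Data.Sum using (inj₁; inj₂)
  open import Data.Unit using (tt)
  open import Function using (_∘_)
  open import Relation.Binary.PropositionalEquality
  open import Relation.Nullary using (does)
  open import Defs using (Digraph; adj; noLoop; nth; outdeg; indeg)
  open Counting
  open SortedSequences
  open DegreeConditions using (Alternative)

  #-two-missing : ∀ {n} (P : Fin n → Bool) a b → a ≢ b → P a ≡ false → P b ≡ false → 2 + # P ≤ n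
  #-two-missing {n} P a b a≢b Pa Pb = begin
      2 + # P                       ≡⟨ +-comm 2 (# P) ⟩
      # P + 2                       ≤⟨ +-monoʳ-≤ (# P) two≤#¬P ⟩
      # P + # (not ∘ P)             ≡⟨ #-compl P ⟩
      n                             ∎
    where
      open ≤-Reasoning
      at-a : T (not (P a) ∧ does (a ≟ᶠ a))
      at-a = ∧-intro (not (P a)) (does (a ≟ᶠ a)) (subst (T ∘ not) (sym Pa) tt) (⇒does (a ≟ᶠ a) refl)
      at-b : T (not (P b) ∧ not (does (b ≟ᶠ a)))
      at-b = ∧-intro (not (P b)) (not (does (b ≟ᶠ a))) (subst (T ∘ not) (sym Pb) tt) (⇒not-does (b ≟ᶠ a) (a≢b ∘ sym))
      two≤#¬P : 2 ≤ # (not ∘ P)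
      two≤#¬P = ≤-trans
        (+-mono-≤ (#-point {P = λ v → not (P v) ∧ does (v ≟ᶠ a)} a at-a)
                  (#-point {P = λ v → not (P v) ∧ not (does (v ≟ᶠ a))} b at-b))
        (≤-reflexive (sym (#-split (not ∘ P) (λ v → does (v ≟ᶠ a)))))

  -- If the (k+1)-st smallest indegree is at least n - 1, then all but at most k
  -- vertices receive an edge from every other vertex, so every vertex has
  -- outdegree at least n - (k + 1).
  outdeg-≥ : ∀ {n} (G : Digraph n) k → n ∸ 1 ≤ nth (sorted (indeg G)) k → ∀ u → n ∸ suc k ≤ outdeg G u
  outdeg-≥ {n} G k n-1≤dₖ u = m≤n+o⇒m∸n≤o n (suc k) (begin
      n                                         ≡⟨ sym (#-compl (λ v → does (indeg G v <? n ∸ 1))) ⟩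
      # (λ v → does (indeg G v <? n ∸ 1)) + # full ≤⟨ +-mono-≤ (few-below (indeg G) k (n ∸ 1) n-1≤dₖ) #full≤ ⟩
      k + (outdeg G u + 1)                      ≡⟨ cong (k +_) (+-comm (outdeg G u) 1) ⟩
      k + suc (outdeg G u)                      ≡⟨ +-suc k (outdeg G u) ⟩
      suc k + outdeg G u                        ∎)
    where
      open ≤-Reasoning
      full : Fin n → Bool
      full v = not (does (indeg G v <? n ∸ 1))

      full⇒adj : ∀ v → T (full v ∧ not (does (v ≟ᶠ u))) → T (adj G u v)
      full⇒adj v full∧v≢u with adj G u v in u↛v
      ... | true  = tt
      ... | false = ⊥-elim (<-irrefl refl (begin-strict
            n                     ≤⟨ m≤n+m∸n n 1 ⟩
            1 + (n ∸ 1)           <⟨ s≤s (+-monoʳ-≤ 1 n-1≤indeg) ⟩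
            2 + indeg G v         ≡⟨ cong (2 +_) (count≡# (λ w → adj G w v)) ⟩
            2 + # (λ w → adj G w v) ≤⟨ #-two-missing (λ w → adj G w v) u v (u≢v ∘ sym) u↛v (noLoop G v) ⟩
            n                     ∎))
        where
          n-1≤indeg : n ∸ 1 ≤ indeg G v
          n-1≤indeg = ≮⇒≥ (not-does⇒ (indeg G v <? n ∸ 1) (∧-fst (full v) _ full∧v≢u))
          u≢v : v ≢ u
          u≢v = not-does⇒ (v ≟ᶠ u) (∧-snd (full v) _ full∧v≢u)

      #full≤ : # full ≤ outdeg G u + 1
      #full≤ = begin
        # full                                          ≤⟨ #-≤-split full (λ v → not (does (v ≟ᶠ u))) ⟩
        # (λ v → full v ∧ not (does (v ≟ᶠ u))) + # is-u ≤⟨ +-mono-≤ (#-mono full⇒adj) (≤-trans (#-mono is-u⇒≡u) (#-singleton u)) ⟩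
        # (adj G u) + 1                                 ≡⟨ cong (_+ 1) (sym (count≡# (adj G u))) ⟩
        outdeg G u + 1                                  ∎
        where
          is-u : Fin n → Bool
          is-u v = not (not (does (v ≟ᶠ u)))
          is-u⇒≡u : ∀ v → T (is-u v) → T (does (v ≟ᶠ u))
          is-u⇒≡u v p with does (v ≟ᶠ u)
          ... | true = p

  min-outdeg : ∀ {n} (G : Digraph n) e → 1 ≤ n →
    Alternative n e (sorted (outdeg G)) (sorted (indeg G)) 1 → e < nth (sorted (outdeg G)) 0
  min-outdeg G e _   (inj₁ 1+e≤d₁) = 1+e≤d₁
  min-outdeg {n} G e n≥1 (inj₂ (k , k+1+1+e≤n , n-1≤dₖ₊₁)) =
    minimum-≥ (outdeg G) (suc e) n≥1 λ u → ≤-trans e<n-[k+1] (outdeg-≥ G k n-1≤dₖ₊₁ u)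
    where
      rearrange : ∀ k e → suc e + suc k ≡ suc k + 1 + e
      rearrange = solve-∀
      e<n-[k+1] : suc e ≤ n ∸ suc k
      e<n-[k+1] = m+n≤o⇒m≤o∸n (suc e) (≤-trans (≤-reflexive (rearrange k e)) k+1+1+e≤n)

module ParameterInequalities where

  open import Data.Nat
  open import Data.Nat.Properties
  open import Data.Nat.Tactic.RingSolver using (solve-∀)
  open import Relation.Binary.PropositionalEquality

  -- The expansion argument bounds the number of edges from S to vertices
  -- outside R by nx and compares nx with two products; both comparisons
  -- follow from nx < (t + 1)² once t ≥ 1, 2x < t and 4t ≤ e.

  markov-bound-small : ∀ n t x → 1 ≤ t → n * x < suc t * suc t → n * x < suc t * (t + t)
  markov-bound-small n t x t≥1 nx<[t+1]² =
    <-≤-trans nx<[t+1]² (*-monoʳ-≤ (suc t) (≤-trans (≤-reflexive (+-comm 1 t)) (+-monoʳ-≤ t t≥1)))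

  markov-bound-large : ∀ n t x e → 1 ≤ t → 2 * x < t → 4 * t ≤ e → n * x < suc t * suc t →
                       n * x < (suc e ∸ t) * (t ∸ x)
  markov-bound-large n t x e t≥1 2x<t 4t≤e nx<[t+1]² =
    <-≤-trans nx<[t+1]² (*-cancelˡ-≤ 2 (begin
      2 * (suc t * suc t)         ≡⟨ double (suc t) ⟩
      (suc t + suc t) * suc t     ≤⟨ *-mono-≤ 2[t+1]≤a t+1≤2b ⟩
      a * (b + b)                 ≡⟨ *-double a b ⟩
      2 * (a * b)                 ∎))
    where
      open ≤-Reasoning
      a = suc e ∸ t
      b = t ∸ x
      double : ∀ x → 2 * (x * x) ≡ (x + x) * x
      double = solve-∀
      *-double : ∀ x y → x * (y + y) ≡ 2 * (x * y)
      *-double = solve-∀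
      three : ∀ t → suc t + suc t + t ≡ 2 + (t + t + t)
      three = solve-∀
      four : ∀ t → suc t + (t + t + t) ≡ suc (4 * t)
      four = solve-∀
      swap : ∀ t x → suc t + (x + x) ≡ t + suc (2 * x)
      swap = solve-∀
      regroup : ∀ b x → b + x + (b + x) ≡ b + b + (x + x)
      regroup = solve-∀
      -- e + 1 - t ≥ 3T + 1 ≥ 2(t + 1)
      2[t+1]≤a : suc t + suc t ≤ a
      2[t+1]≤a = m+n≤o⇒m≤o∸n (suc t + suc t) (begin
        suc t + suc t + t         ≡⟨ three t ⟩
        2 + (t + t + t)           ≤⟨ +-monoˡ-≤ (t + t + t) (s≤s t≥1) ⟩
        suc t + (t + t + t)       ≡⟨ four t ⟩
        suc (4 * t)               ≤⟨ s≤s 4t≤e ⟩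
        suc e                     ∎)
      t+1≤2b : suc t ≤ b + b
      t+1≤2b = +-cancelʳ-≤ (x + x) (suc t) (b + b) (begin
        suc t + (x + x)           ≡⟨ swap t x ⟩
        t + suc (2 * x)           ≤⟨ +-monoʳ-≤ t 2x<t ⟩
        t + t                     ≡⟨ cong₂ _+_ b+x≡t b+x≡t ⟨
        b + x + (b + x)           ≡⟨ regroup b x ⟩
        b + b + (x + x)           ∎)
        where
          b+x≡t : b + x ≡ t
          b+x≡t = m∸n+n≡m (≤-trans (m≤n*m x 2) (<⇒≤ 2x<t))

module Expansion where

  open import Data.Bool using (Bool; true; false; _∧_; not; T)
  open import Data.Empty using (⊥; ⊥-elim)
  open import Data.Fin using (Fin)
  open import Data.Nat
  open import Data.Nat.Properties
  open import Algebra.Properties.CommutativeMonoid.Sum +-0-commutativeMonoid using (sum)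
  open import Data.Nat.Tactic.RingSolver using (solve-∀)
  open import Data.Product using (_,_; proj₁; proj₂)
  open import Data.Sum using (inj₁; inj₂)
  open import Data.Unit using (tt)
  open import Function using (_∘_)
  open import Relation.Binary.PropositionalEquality
  open import Relation.Nullary using (¬_; does; yes; no)
  open import Defs using (Digraph; adj; outdeg; indeg)
  open Counting
  open SortedSequences using (sorted; few-below)
  open DegreeConditions
  open ParameterInequalities

  degIn : ∀ {n} → Digraph n → (Fin n → Bool) → Fin n → ℕ
  degIn G S v = # (λ u → S u ∧ adj G u v)

  private
    pred-≱ : ∀ {i} → 1 ≤ i → ¬ (i ≤ i ∸ 1)
    pred-≱ {suc _} _ = 1+n≰n

  -- Fix a digraph satisfying the degree condition with integer threshold e,
  -- integers t ≥ 1 and x with 2x < t, 4t ≤ e and nx < (t + 1)² (in the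
  -- theorem e, t, x are the floors of ηn, τn, τ²n), and a set S.
  module _ {n : ℕ} (G : Digraph n) (e t x : ℕ) (t≥1 : 1 ≤ t) (2x<t : 2 * x < t) (4t≤e : 4 * t ≤ e)
           (nx<[t+1]² : n * x < suc t * suc t) (degreeCondition : DegreeCondition e G)
           (S : Fin n → Bool) where

    R : Fin n → Bool
    R v = does (x <? degIn G S v)

    f : Fin n → ℕ
    f u = # (λ v → S u ∧ adj G u v ∧ not (R v))

    s s̄ r r̄ : ℕ
    s = # S
    s̄ = # (not ∘ S)
    r = # R
    r̄ = # (not ∘ R)

    x<t : x < t
    x<t = ≤-<-trans (m≤n*m x 2) 2x<t

    x+3t≤e : x + (t + t + t) ≤ e
    x+3t≤e = begin
        x + (t + t + t)   ≤⟨ +-monoˡ-≤ (t + t + t) (<⇒≤ x<t) ⟩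
        t + (t + t + t)   ≡⟨ four t ⟩
        4 * t             ≤⟨ 4t≤e ⟩
        e                 ∎
      where
        open ≤-Reasoning
        four : ∀ t → t + (t + t + t) ≡ 4 * t
        four = solve-∀

    x+t<e : x + t < e
    x+t<e = <-≤-trans (+-monoˡ-< t x<t) (≤-trans (+-monoʳ-≤ t (m≤m+n t _)) 4t≤e)

    outside-R : ∀ v → T (not (R v)) → degIn G S v ≤ x
    outside-R v v∉R = ≮⇒≥ (not-does⇒ (x <? degIn G S v) v∉R)

    -- double counting: each vertex outside R receives at most x edges from S
    edges-leaving : sum f ≤ n * x
    edges-leaving = begin
        sum f                                                   ≡⟨ double-counting (λ u v → S u ∧ adj G u v ∧ not (R v)) ⟩
        sum (λ v → # (λ u → S u ∧ adj G u v ∧ not (R v)))       ≤⟨ ∑-≤-const x into ⟩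
        n * x                                                   ∎
      where
        open ≤-Reasoning
        into : ∀ v → # (λ u → S u ∧ adj G u v ∧ not (R v)) ≤ x
        into v with R v in v∈R
        ... | true  = ≤-trans (≤-reflexive (#-none none)) z≤n
          where
            none : ∀ u → ¬ T (S u ∧ adj G u v ∧ false)
            none u p = ∧-snd (adj G u v) false (∧-snd (S u) (adj G u v ∧ false) p)
        ... | false = ≤-trans (#-mono from-S) (outside-R v (subst (T ∘ not) (sym v∈R) tt))
          where
            from-S : ∀ u → T (S u ∧ adj G u v ∧ true) → T (S u ∧ adj G u v)
            from-S u p = ∧-intro (S u) (adj G u v) (∧-fst (S u) _ p) (∧-fst (adj G u v) true (∧-snd (S u) _ p))

    indeg-≤ : ∀ v → indeg G v ≤ degIn G S v + s̄
    indeg-≤ v = begin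
        indeg G v                        ≡⟨ count≡# (λ u → adj G u v) ⟩
        # (λ u → adj G u v)              ≤⟨ #-≤-split (λ u → adj G u v) S ⟩
        # (λ u → adj G u v ∧ S u) + s̄    ≤⟨ +-monoˡ-≤ s̄ (#-mono from-S) ⟩
        degIn G S v + s̄                  ∎
      where
        open ≤-Reasoning
        from-S : ∀ u → T (adj G u v ∧ S u) → T (S u ∧ adj G u v)
        from-S u p = ∧-intro (S u) (adj G u v) (∧-snd (adj G u v) (S u) p) (∧-fst (adj G u v) (S u) p)

    outdeg-≤ : ∀ u → T (S u) → outdeg G u ≤ r + f u
    outdeg-≤ u u∈S = begin
        outdeg G u                                                  ≡⟨ count≡# (adj G u) ⟩
        # (adj G u)                                                 ≡⟨ #-split (adj G u) R ⟩
        # (λ v → adj G u v ∧ R v) + # (λ v → adj G u v ∧ not (R v)) ≤⟨ +-mono-≤ (#-mono into-R) (#-mono leaving) ⟩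
        r + f u                                                     ∎
      where
        open ≤-Reasoning
        into-R : ∀ v → T (adj G u v ∧ R v) → T (R v)
        into-R v p = ∧-snd (adj G u v) (R v) p
        leaving : ∀ v → T (adj G u v ∧ not (R v)) → T (S u ∧ adj G u v ∧ not (R v))
        leaving v p = ∧-intro (S u) (adj G u v ∧ not (R v)) u∈S p

    outside-R-≤ : ∀ u → T (S u) → r̄ ≤ f u + # (not ∘ adj G u)
    outside-R-≤ u u∈S = begin
        r̄                                                    ≤⟨ #-≤-split (not ∘ R) (adj G u) ⟩
        # (λ v → not (R v) ∧ adj G u v) + # (not ∘ adj G u)  ≤⟨ +-monoˡ-≤ (# (not ∘ adj G u)) (#-mono leaving) ⟩
        f u + # (not ∘ adj G u)                              ∎
      where
        open ≤-Reasoning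
        leaving : ∀ v → T (not (R v) ∧ adj G u v) → T (S u ∧ adj G u v ∧ not (R v))
        leaving v p = ∧-intro (S u) (adj G u v ∧ not (R v)) u∈S
          (∧-intro (adj G u v) (not (R v)) (∧-snd (not (R v)) (adj G u v) p) (∧-fst (not (R v)) (adj G u v) p))

    -- Suppose, for a contradiction, that R is small: r ≤ s + x.
    module _ (r≤s+x : r ≤ s + x) where

      -- If 2(s - t) < n, condition (i) for i = s - t fails: at least i vertices
      -- of S have outdegree below i + e, while few vertices have indegree n - i.
      small-S : t < s → 2 * (s ∸ t) < n → ⊥
      small-S t<s 2i<n = refute (proj₁ (degreeCondition i i≥1 2i<n))
        where
          open ≤-Reasoning
          i = s ∸ t
          i+t≡s : i + t ≡ s
          i+t≡s = m∸n+n≡m (<⇒≤ t<s)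
          i≥1 : 1 ≤ i
          i≥1 = m<n⇒0<n∸m t<s

          -- by Markov's inequality at most t vertices send 2t edges outside R
          heavy : Fin n → Bool
          heavy u = does (t + t ≤? f u)
          #heavy≤t : # heavy ≤ t
          #heavy≤t = s≤s⁻¹ (*-cancelʳ-< (t + t) (# heavy) (suc t) (begin-strict
              # heavy * (t + t)   ≤⟨ markov f (t + t) ⟩
              sum f               ≤⟨ edges-leaving ⟩
              n * x               <⟨ markov-bound-small n t x t≥1 nx<[t+1]² ⟩
              suc t * (t + t)     ∎))

          light : Fin n → Bool
          light u = S u ∧ does (f u <? t + t)
          i≤#light : i ≤ # light
          i≤#light = +-cancelʳ-≤ t i (# light) (begin
              i + t                                          ≡⟨ i+t≡s ⟩
              s                                              ≤⟨ #-≤-split S (λ u → does (f u <? t + t)) ⟩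
              # light + # (λ u → not (does (f u <? t + t)))  ≤⟨ +-monoʳ-≤ (# light) (≤-trans (#-mono not-light⇒heavy) #heavy≤t) ⟩
              # light + t                                    ∎)
            where
              not-light⇒heavy : ∀ u → T (not (does (f u <? t + t))) → T (heavy u)
              not-light⇒heavy u p = ⇒does (t + t ≤? f u) (≮⇒≥ (not-does⇒ (f u <? t + t) p))

          light⇒outdeg< : ∀ u → T (light u) → outdeg G u < i + e
          light⇒outdeg< u p = begin-strict
              outdeg G u              ≤⟨ outdeg-≤ u (∧-fst (S u) _ p) ⟩
              r + f u                 <⟨ +-mono-≤-< r≤s+x (does⇒ (f u <? t + t) (∧-snd (S u) _ p)) ⟩
              s + x + (t + t)         ≡⟨ cong (λ y → y + x + (t + t)) i+t≡s ⟨
              i + t + x + (t + t)     ≡⟨ regroup i t x ⟩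
              i + (x + (t + t + t))   ≤⟨ +-monoʳ-≤ i x+3t≤e ⟩
              i + e                   ∎
            where
              regroup : ∀ i t x → i + t + x + (t + t) ≡ i + (x + (t + t + t))
              regroup = solve-∀

          -- a vertex of indegree ≥ n - i = t + s̄ has ≥ t > x inneighbours in S
          n∸i≡t+s̄ : n ∸ i ≡ t + s̄
          n∸i≡t+s̄ = begin-equality
              n ∸ i               ≡⟨ cong (_∸ i) (#-compl S) ⟨
              s + s̄ ∸ i           ≡⟨ cong (λ y → y + s̄ ∸ i) i+t≡s ⟨
              i + t + s̄ ∸ i       ≡⟨ cong (_∸ i) (+-assoc i t s̄) ⟩
              i + (t + s̄) ∸ i     ≡⟨ m+n∸m≡n i (t + s̄) ⟩
              t + s̄               ∎

          high-indeg : Fin n → Bool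
          high-indeg v = not (does (indeg G v <? n ∸ i))
          high-indeg⇒R : ∀ v → T (high-indeg v) → T (R v)
          high-indeg⇒R v p = ⇒does (x <? degIn G S v) (<-≤-trans x<t (+-cancelʳ-≤ s̄ t (degIn G S v) (begin
              t + s̄               ≡⟨ n∸i≡t+s̄ ⟨
              n ∸ i               ≤⟨ ≮⇒≥ (not-does⇒ (indeg G v <? n ∸ i) p) ⟩
              indeg G v           ≤⟨ indeg-≤ v ⟩
              degIn G S v + s̄     ∎)))

          refute : Alternative n e (sorted (outdeg G)) (sorted (indeg G)) i → ⊥
          refute (inj₁ i+e≤dᵢ) = pred-≱ i≥1 (begin
              i                                       ≤⟨ i≤#light ⟩
              # light                                 ≤⟨ #-mono (λ u p → ⇒does (outdeg G u <? i + e) (light⇒outdeg< u p)) ⟩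
              # (λ u → does (outdeg G u <? i + e))    ≤⟨ few-below (outdeg G) (i ∸ 1) (i + e) i+e≤dᵢ ⟩
              i ∸ 1                                   ∎)
          refute (inj₂ (k , k+1+i+e≤n , n-i≤dₖ₊₁)) = <-asym x+t<e (+-cancelˡ-≤ (k + i) (suc e) (x + t) (begin
              k + i + suc e                                         ≡⟨ shift k i e ⟩
              suc k + i + e                                         ≤⟨ k+1+i+e≤n ⟩
              n                                                     ≡⟨ #-compl (λ v → does (indeg G v <? n ∸ i)) ⟨
              # (λ v → does (indeg G v <? n ∸ i)) + # high-indeg    ≤⟨ +-mono-≤ (few-below (indeg G) k (n ∸ i) n-i≤dₖ₊₁) (#-mono high-indeg⇒R) ⟩
              k + r                                                 ≤⟨ +-monoʳ-≤ k r≤s+x ⟩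
              k + (s + x)                                           ≡⟨ cong (λ y → k + (y + x)) i+t≡s ⟨
              k + (i + t + x)                                       ≡⟨ regroup k i t x ⟩
              k + i + (x + t)                                       ∎))
            where
              shift : ∀ k i e → k + i + suc e ≡ suc k + i + e
              shift = solve-∀
              regroup : ∀ k i t x → k + (i + t + x) ≡ k + i + (x + t)
              regroup = solve-∀

      -- If n ≤ 2(s - t), condition (ii) for i = s̄ - t fails: at least i vertices
      -- lie outside R and have indegree below i + e, while the many vertices of
      -- S with outdegree ≥ n - i send too many edges outside R.
      large-S : t + s < n → n ≤ 2 * (s ∸ t) → ⊥
      large-S t+s<n n≤2[s-t] = refute (proj₂ (degreeCondition i i≥1 2i<n))
        where
          open ≤-Reasoning
          s+s̄≡n : s + s̄ ≡ n
          s+s̄≡n = #-compl S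
          t<s̄ : t < s̄
          t<s̄ = +-cancelˡ-< s t s̄ (begin-strict
              s + t     ≡⟨ +-comm s t ⟩
              t + s     <⟨ t+s<n ⟩
              n         ≡⟨ s+s̄≡n ⟨
              s + s̄     ∎)
          i = s̄ ∸ t
          i+t≡s̄ : i + t ≡ s̄
          i+t≡s̄ = m∸n+n≡m (<⇒≤ t<s̄)
          i≥1 : 1 ≤ i
          i≥1 = m<n⇒0<n∸m t<s̄
          i<s̄ : i < s̄
          i<s̄ = <-≤-trans (m<m+n i t≥1) (≤-reflexive i+t≡s̄)
          s̄≤s : s̄ ≤ s
          s̄≤s = +-cancelˡ-≤ s s̄ s (begin
              s + s̄             ≡⟨ s+s̄≡n ⟩
              n                 ≤⟨ n≤2[s-t] ⟩
              2 * (s ∸ t)       ≤⟨ *-monoʳ-≤ 2 (m∸n≤m s t) ⟩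
              2 * s             ≡⟨ cong (s +_) (+-identityʳ s) ⟩
              s + s             ∎)
          2i<n : 2 * i < n
          2i<n = begin-strict
              2 * i             ≡⟨ cong (i +_) (+-identityʳ i) ⟩
              i + i             <⟨ +-mono-<-≤ i<s̄ (≤-trans (<⇒≤ i<s̄) s̄≤s) ⟩
              s̄ + s             ≡⟨ +-comm s̄ s ⟩
              s + s̄             ≡⟨ s+s̄≡n ⟩
              n                 ∎

          -- as R is small, at least i + t - x ≥ i vertices lie outside R
          i+t≤r̄+x : i + t ≤ r̄ + x
          i+t≤r̄+x = +-cancelˡ-≤ s (i + t) (r̄ + x) (begin
              s + (i + t)       ≡⟨ cong (s +_) i+t≡s̄ ⟩
              s + s̄             ≡⟨ s+s̄≡n ⟩
              n                 ≡⟨ #-compl R ⟨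
              r + r̄             ≤⟨ +-monoˡ-≤ r̄ r≤s+x ⟩
              s + x + r̄         ≡⟨ +-assoc s x r̄ ⟩
              s + (x + r̄)       ≡⟨ cong (s +_) (+-comm x r̄) ⟩
              s + (r̄ + x)       ∎)
          i≤r̄ : i ≤ r̄
          i≤r̄ = +-cancelʳ-≤ t i r̄ (≤-trans i+t≤r̄+x (+-monoʳ-≤ r̄ (<⇒≤ x<t)))

          outside-R⇒indeg< : ∀ v → T (not (R v)) → indeg G v < i + e
          outside-R⇒indeg< v v∉R = begin-strict
              indeg G v         ≤⟨ indeg-≤ v ⟩
              degIn G S v + s̄   ≤⟨ +-monoˡ-≤ s̄ (outside-R v v∉R) ⟩
              x + s̄             ≡⟨ cong (x +_) i+t≡s̄ ⟨
              x + (i + t)       ≡⟨ regroup x i t ⟩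
              i + (x + t)       <⟨ +-monoʳ-< i x+t<e ⟩
              i + e             ∎
            where
              regroup : ∀ x i t → x + (i + t) ≡ i + (x + t)
              regroup = solve-∀

          refute : Alternative n e (sorted (indeg G)) (sorted (outdeg G)) i → ⊥
          refute (inj₁ i+e≤dᵢ) = pred-≱ i≥1 (begin
              i                                     ≤⟨ i≤r̄ ⟩
              r̄                                     ≤⟨ #-mono (λ v p → ⇒does (indeg G v <? i + e) (outside-R⇒indeg< v p)) ⟩
              # (λ v → does (indeg G v <? i + e))   ≤⟨ few-below (indeg G) (i ∸ 1) (i + e) i+e≤dᵢ ⟩
              i ∸ 1                                 ∎)
          refute (inj₂ (k , k+1+i+e≤n , n-i≤dₖ₊₁)) = <-irrefl refl (begin-strict
              (suc e ∸ t) * (t ∸ x)   ≤⟨ *-monoˡ-≤ (t ∸ x) e+1-t≤#far ⟩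
              # far * (t ∸ x)         ≤⟨ markov f (t ∸ x) ⟩
              sum f                   ≤⟨ edges-leaving ⟩
              n * x                   <⟨ markov-bound-large n t x e t≥1 2x<t 4t≤e nx<[t+1]² ⟩
              (suc e ∸ t) * (t ∸ x)   ∎)
            where
              far : Fin n → Bool
              far u = does (t ∸ x ≤? f u)
              high : Fin n → Bool
              high u = not (does (outdeg G u <? n ∸ i))

              i≤n : i ≤ n
              i≤n = ≤-trans (<⇒≤ i<s̄) (≤-trans (m≤n+m s̄ s) (≤-reflexive s+s̄≡n))

              -- u ∈ S of outdegree ≥ n - i misses at most i vertices, so it sends
              -- at least r̄ - i ≥ t - x edges outside R
              high∧S⇒far : ∀ u → T (high u ∧ S u) → T (far u)
              high∧S⇒far u p = ⇒does (t ∸ x ≤? f u) (m≤n+o⇒m∸n≤o t x (+-cancelˡ-≤ i t (x + f u) (begin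
                  i + t                         ≤⟨ i+t≤r̄+x ⟩
                  r̄ + x                         ≤⟨ +-monoˡ-≤ x (outside-R-≤ u u∈S) ⟩
                  f u + # (not ∘ adj G u) + x   ≤⟨ +-monoˡ-≤ x (+-monoʳ-≤ (f u) missing≤i) ⟩
                  f u + i + x                   ≡⟨ regroup (f u) i x ⟩
                  i + (x + f u)                 ∎)))
                where
                  u∈S = ∧-snd (high u) (S u) p
                  n-i≤outdeg : n ∸ i ≤ # (adj G u)
                  n-i≤outdeg = subst (n ∸ i ≤_) (count≡# (adj G u)) (≮⇒≥ (not-does⇒ (outdeg G u <? n ∸ i) (∧-fst (high u) (S u) p)))
                  missing≤i : # (not ∘ adj G u) ≤ i
                  missing≤i = +-cancelˡ-≤ (n ∸ i) (# (not ∘ adj G u)) i (begin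
                      n ∸ i + # (not ∘ adj G u)       ≤⟨ +-monoˡ-≤ (# (not ∘ adj G u)) n-i≤outdeg ⟩
                      # (adj G u) + # (not ∘ adj G u) ≡⟨ #-compl (adj G u) ⟩
                      n                               ≡⟨ m∸n+n≡m i≤n ⟨
                      n ∸ i + i                       ∎)
                  regroup : ∀ f i x → f + i + x ≡ i + (x + f)
                  regroup = solve-∀

              e+1≤t+#high∧S : suc e ≤ t + # (λ u → high u ∧ S u)
              e+1≤t+#high∧S = +-cancelˡ-≤ (k + i) (suc e) (t + # (λ u → high u ∧ S u)) (begin
                  k + i + suc e                                        ≡⟨ shift k i e ⟩
                  suc k + i + e                                        ≤⟨ k+1+i+e≤n ⟩
                  n                                                    ≡⟨ #-compl (λ u → does (outdeg G u <? n ∸ i)) ⟨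
                  # (λ u → does (outdeg G u <? n ∸ i)) + # high        ≤⟨ +-mono-≤ (few-below (outdeg G) k (n ∸ i) n-i≤dₖ₊₁) (#-≤-split high S) ⟩
                  k + (# (λ u → high u ∧ S u) + s̄)                     ≡⟨ cong (λ y → k + (# (λ u → high u ∧ S u) + y)) i+t≡s̄ ⟨
                  k + (# (λ u → high u ∧ S u) + (i + t))               ≡⟨ regroup k (# (λ u → high u ∧ S u)) i t ⟩
                  k + i + (t + # (λ u → high u ∧ S u))                 ∎)
                where
                  shift : ∀ k i e → k + i + suc e ≡ suc k + i + e
                  shift = solve-∀
                  regroup : ∀ k h i t → k + (h + (i + t)) ≡ k + i + (t + h)
                  regroup = solve-∀

              e+1-t≤#far : suc e ∸ t ≤ # far
              e+1-t≤#far = ≤-trans (m≤n+o⇒m∸n≤o (suc e) t e+1≤t+#high∧S) (#-mono high∧S⇒far)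

    expands : t < s → t + s < n → s + x < r
    expands t<s t+s<n with r ≤? s + x
    ... | no r≰s+x = ≰⇒> r≰s+x
    ... | yes r≤s+x with 2 * (s ∸ t) <? n
    ...   | yes small = ⊥-elim (small-S r≤s+x t<s small)
    ...   | no  large = ⊥-elim (large-S r≤s+x t+s<n (≮⇒≥ large))

module Thresholds where

  open import Data.Bool using (Bool; _∧_; T)
  open import Data.Fin using (Fin)
  import Data.Fin.Subset as Sub
  open import Data.Integer as ℤ using (ℤ; +_; -[1+_])
  open import Data.Nat as ℕ using (ℕ; zero; suc; z≤n; s≤s; _∸_)
  import Data.Nat.Properties as ℕ
  open import Data.Product using (Σ; _×_; _,_; proj₁; proj₂)
  open import Data.Rational
  open import Data.Rational.Properties
  open import Data.Rational.Solver using (module +-*-Solver)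
  open import Data.Sum using (_⊎_; inj₁; inj₂)
  open import Data.Vec using (lookup)
  open import Relation.Binary.PropositionalEquality
  open import Relation.Nullary using (does)
  open import Defs
  open Counting using (#; count≡#; ∣S∣≡#; #-mono; does⇒; ⇒does)
  open SortedSequences using (sorted)
  open DegreeConditions
  open MinimumDegree using (min-outdeg)
  open Expansion using (degIn; expands)
  open NaturalsInRationals

  *-monoˡ-≤-≥0 : ∀ {r p q} → 0ℚ ≤ r → p ≤ q → r * p ≤ r * q
  *-monoˡ-≤-≥0 {r} 0≤r = *-monoˡ-≤-nonNeg r {{nonNegative 0≤r}}

  *-monoʳ-≤-≥0 : ∀ {r p q} → 0ℚ ≤ r → p ≤ q → p * r ≤ q * r
  *-monoʳ-≤-≥0 {r} 0≤r = *-monoʳ-≤-nonNeg r {{nonNegative 0≤r}}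

  *-≥0 : ∀ {p q} → 0ℚ ≤ p → 0ℚ ≤ q → 0ℚ ≤ p * q
  *-≥0 {p} {q} 0≤p 0≤q = nonNegative⁻¹ (p * q) {{nonNeg*nonNeg⇒nonNeg p {{nonNegative 0≤p}} q {{nonNegative 0≤q}}}}

  ¼ : ℚ
  ¼ = + 1 / 4

  0<η¼ : ∀ {η} → 0ℚ < η → 0ℚ < η * ¼
  0<η¼ {η} 0<η = positive⁻¹ (η * ¼) {{pos*pos⇒pos η {{positive 0<η}} ¼}}

  4τ≤η : ∀ {η τ} → τ ≤ η * ¼ → ℕtoℚ 4 * τ ≤ η
  4τ≤η {η} {τ} τ≤η¼ = begin
      ℕtoℚ 4 * τ           ≤⟨ *-monoˡ-≤-≥0 (ℕtoℚ-nonNeg 4) τ≤η¼ ⟩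
      ℕtoℚ 4 * (η * ¼)     ≡⟨ exchange (ℕtoℚ 4) η ¼ ⟩
      η * (ℕtoℚ 4 * ¼)     ≡⟨ cong (η *_) 4¼≡1 ⟩
      η * 1ℚ               ≡⟨ *-identityʳ η ⟩
      η                    ∎
    where
      open ≤-Reasoning
      open +-*-Solver
      exchange : ∀ a b c → a * (b * c) ≡ b * (a * c)
      exchange = solve 3 (λ a b c → a :* (b :* c) := b :* (a :* c)) refl
      4¼≡1 : ℕtoℚ 4 * ¼ ≡ 1ℚ
      4¼≡1 = refl

  reverse : ∀ {n} → Digraph n → Digraph n
  reverse G = record { adj = λ u v → adj G v u ; noLoop = noLoop G }

  module _ (η τ : ℚ) (n : ℕ) (0<η : 0ℚ < η) (0<τ : 0ℚ < τ) (4τ≤η : ℕtoℚ 4 * τ ≤ η) (η<1 : η < 1ℚ)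
           (1≤τn : ℕtoℚ 1 ≤ τ * ℕtoℚ n) where

    τn τ²n ηn : ℚ
    τn  = τ * ℕtoℚ n
    τ²n = (τ * τ) * ℕtoℚ n
    ηn  = η * ℕtoℚ n

    0≤τn : 0ℚ ≤ τn
    0≤τn = ≤-trans (ℕtoℚ-nonNeg 1) 1≤τn

    0≤τ²n : 0ℚ ≤ τ²n
    0≤τ²n = *-≥0 (*-≥0 (<⇒≤ 0<τ) (<⇒≤ 0<τ)) (ℕtoℚ-nonNeg n)

    0≤ηn : 0ℚ ≤ ηn
    0≤ηn = *-≥0 (<⇒≤ 0<η) (ℕtoℚ-nonNeg n)

    t x e : ℕ
    t = proj₁ (floor-ℕ τn 0≤τn)
    x = proj₁ (floor-ℕ τ²n 0≤τ²n)
    e = proj₁ (floor-ℕ ηn 0≤ηn)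

    t≤τn : ℕtoℚ t ≤ τn
    t≤τn = proj₁ (proj₂ (floor-ℕ τn 0≤τn))
    τn<t+1 : τn < ℕtoℚ (suc t)
    τn<t+1 = proj₂ (proj₂ (floor-ℕ τn 0≤τn))
    x≤τ²n : ℕtoℚ x ≤ τ²n
    x≤τ²n = proj₁ (proj₂ (floor-ℕ τ²n 0≤τ²n))
    τ²n<x+1 : τ²n < ℕtoℚ (suc x)
    τ²n<x+1 = proj₂ (proj₂ (floor-ℕ τ²n 0≤τ²n))
    e≤ηn : ℕtoℚ e ≤ ηn
    e≤ηn = proj₁ (proj₂ (floor-ℕ ηn 0≤ηn))
    ηn<e+1 : ηn < ℕtoℚ (suc e)
    ηn<e+1 = proj₂ (proj₂ (floor-ℕ ηn 0≤ηn))

    t≥1 : 1 ℕ.≤ t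
    t≥1 = ≤-floor 1≤τn τn<t+1

    -- 4τ ≤ η < 1, so 4τ²n ≤ τn
    4τ²n≤τn : ℕtoℚ 4 * τ²n ≤ τn
    4τ²n≤τn = begin
        ℕtoℚ 4 * τ²n        ≡⟨ regroup (ℕtoℚ 4) τ (ℕtoℚ n) ⟩
        (ℕtoℚ 4 * τ) * τn   ≤⟨ *-monoʳ-≤-≥0 0≤τn (≤-trans 4τ≤η (<⇒≤ η<1)) ⟩
        1ℚ * τn             ≡⟨ *-identityˡ τn ⟩
        τn                  ∎
      where
        open ≤-Reasoning
        open +-*-Solver
        regroup : ∀ a τ m → a * ((τ * τ) * m) ≡ (a * τ) * (τ * m)
        regroup = solve 3 (λ a τ m → a :* ((τ :* τ) :* m) := (a :* τ) :* (τ :* m)) refl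

    2x<t : 2 ℕ.* x ℕ.< t
    2x<t = double<quadruple x t t≥1 (≤-floor (begin
        ℕtoℚ (4 ℕ.* x)      ≡⟨ ℕtoℚ-* 4 x ⟩
        ℕtoℚ 4 * ℕtoℚ x     ≤⟨ *-monoˡ-≤-≥0 (ℕtoℚ-nonNeg 4) x≤τ²n ⟩
        ℕtoℚ 4 * τ²n        ≤⟨ 4τ²n≤τn ⟩
        τn                  ∎) τn<t+1)
      where
        open ≤-Reasoning
        double<quadruple : ∀ x t → 1 ℕ.≤ t → 4 ℕ.* x ℕ.≤ t → 2 ℕ.* x ℕ.< t
        double<quadruple zero    t t≥1 _    = t≥1
        double<quadruple (suc x) t _   4x≤t = ℕ.<-≤-trans (ℕ.*-monoˡ-< (suc x) 2<4) 4x≤t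
          where
            2<4 : 2 ℕ.< 4
            2<4 = s≤s (s≤s (s≤s z≤n))

    4t≤e : 4 ℕ.* t ℕ.≤ e
    4t≤e = ≤-floor (begin
        ℕtoℚ (4 ℕ.* t)      ≡⟨ ℕtoℚ-* 4 t ⟩
        ℕtoℚ 4 * ℕtoℚ t     ≤⟨ *-monoˡ-≤-≥0 (ℕtoℚ-nonNeg 4) t≤τn ⟩
        ℕtoℚ 4 * τn         ≡⟨ *-assoc (ℕtoℚ 4) τ (ℕtoℚ n) ⟨
        (ℕtoℚ 4 * τ) * ℕtoℚ n ≤⟨ *-monoʳ-≤-≥0 (ℕtoℚ-nonNeg n) 4τ≤η ⟩
        ηn                  ∎) ηn<e+1
      where open ≤-Reasoning

    nx<[t+1]² : n ℕ.* x ℕ.< suc t ℕ.* suc t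
    nx<[t+1]² = ℕtoℚ-cancel-< (begin-strict
        ℕtoℚ (n ℕ.* x)                 ≡⟨ ℕtoℚ-* n x ⟩
        ℕtoℚ n * ℕtoℚ x                ≤⟨ *-monoˡ-≤-≥0 (ℕtoℚ-nonNeg n) x≤τ²n ⟩
        ℕtoℚ n * τ²n                   ≡⟨ square τ (ℕtoℚ n) ⟩
        τn * τn                        ≤⟨ *-monoˡ-≤-≥0 0≤τn (<⇒≤ τn<t+1) ⟩
        τn * ℕtoℚ (suc t)              <⟨ *-monoˡ-<-pos (ℕtoℚ (suc t)) {{positive (ℕtoℚ-mono-< {0} {suc t} (s≤s z≤n))}} τn<t+1 ⟩
        ℕtoℚ (suc t) * ℕtoℚ (suc t)    ≡⟨ ℕtoℚ-* (suc t) (suc t) ⟨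
        ℕtoℚ (suc t ℕ.* suc t)         ∎)
      where
        open ≤-Reasoning
        open +-*-Solver
        square : ∀ τ m → m * ((τ * τ) * m) ≡ (τ * m) * (τ * m)
        square = solve 2 (λ τ m → m :* ((τ :* τ) :* m) := (τ :* m) :* (τ :* m)) refl

    integer-degree-condition : (G : Digraph n) → DegSeqCond η G → DegreeCondition e G
    integer-degree-condition G dc i i≥1 2i<n =
        convert (sorted (outdeg G)) (sorted (indeg G)) (proj₁ (dc i i≥1 2i<n)) ,
        convert (sorted (indeg G)) (sorted (outdeg G)) (proj₂ (dc i i≥1 2i<n))
      where
        shifted-index : ∀ ds′ z → floor (ℕtoℚ n - ℕtoℚ i - ηn) ≡ z → + 1 ℤ.≤ z →
                        n ∸ i ℕ.≤ nth ds′ (ℤ.∣ z ∣ ∸ 1) → Σ ℕ λ k → suc k ℕ.+ i ℕ.+ e ℕ.≤ n × n ∸ i ℕ.≤ nth ds′ k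
        shifted-index ds′ (+ suc k) ⌊n-i-ηn⌋≡k+1 _ n-i≤dₖ₊₁ = k , ℕtoℚ-cancel-≤ (begin
            ℕtoℚ (suc k ℕ.+ i ℕ.+ e)               ≡⟨ trans (ℕtoℚ-+ (suc k ℕ.+ i) e) (cong (_+ ℕtoℚ e) (ℕtoℚ-+ (suc k) i)) ⟩
            ℕtoℚ (suc k) + ℕtoℚ i + ℕtoℚ e         ≤⟨ +-mono-≤ (+-monoˡ-≤ (ℕtoℚ i) (floor-≤ (ℕtoℚ n - ℕtoℚ i - ηn) (suc k) ⌊n-i-ηn⌋≡k+1)) e≤ηn ⟩
            (ℕtoℚ n - ℕtoℚ i - ηn) + ℕtoℚ i + ηn   ≡⟨ cancel (ℕtoℚ n) (ℕtoℚ i) ηn ⟩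
            ℕtoℚ n                                 ∎) , n-i≤dₖ₊₁
          where
            open ≤-Reasoning
            open +-*-Solver
            cancel : ∀ a b c → (a - b - c) + b + c ≡ a
            cancel = solve 3 (λ a b c → (a :- b :- c) :+ b :+ c := a) refl
        shifted-index ds′ (+ zero) _ (ℤ.+≤+ ()) _
        shifted-index ds′ -[1+ _ ] _ ()         _

        convert : ∀ ds ds′ → (ℕtoℚ i + ηn ≤ ℕtoℚ (nth ds (i ∸ 1))) ⊎ ShiftedDeg≥ (λ j → nth ds′ (j ∸ 1)) n η i →
                  Alternative n e ds ds′ i
        convert ds ds′ (inj₁ i+ηn≤dᵢ) = inj₁ (ℕtoℚ-cancel-≤ (begin
            ℕtoℚ (i ℕ.+ e)      ≡⟨ ℕtoℚ-+ i e ⟩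
            ℕtoℚ i + ℕtoℚ e     ≤⟨ +-monoʳ-≤ (ℕtoℚ i) e≤ηn ⟩
            ℕtoℚ i + ηn         ≤⟨ i+ηn≤dᵢ ⟩
            ℕtoℚ (nth ds (i ∸ 1)) ∎))
          where open ≤-Reasoning
        convert ds ds′ (inj₂ (1≤⌊n-i-ηn⌋ , n-i≤d)) = inj₂ (shifted-index ds′ (shiftIdx n η i) refl 1≤⌊n-i-ηn⌋ n-i≤d)

    -- minimum semidegree: the case i = 1 of (i) and (ii) gives δ⁺, δ⁻ ≥ e + 1 > ηn
    min-semidegree : (G : Digraph n) → DegSeqCond η G → 3 ℕ.≤ n → ηn ≤ ℕtoℚ (δ⁰ G)
    min-semidegree G dc n≥3 = <⇒≤ (<-≤-trans ηn<e+1 (ℕtoℚ-mono-≤ (ℕ.⊓-glb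
        (min-outdeg G e n≥1 (proj₁ (integer-degree-condition G dc 1 (s≤s z≤n) n≥3)))
        (min-outdeg (reverse G) e n≥1 (proj₂ (integer-degree-condition G dc 1 (s≤s z≤n) n≥3))))))
      where
        n≥1 : 1 ℕ.≤ n
        n≥1 = ℕ.≤-trans (s≤s z≤n) n≥3

    -- robust expansion: for τn < |S| < (1 - τ)n, at least |S| + x + 1 > |S| + τ²n
    -- vertices have at least x + 1 > τ²n inneighbours in S
    robust-expander : (G : Digraph n) → DegSeqCond η G → RobustOutexpander (τ * τ) τ G
    robust-expander G dc S τn<s s<[1-τ]n = begin
        ℕtoℚ s + τ²n                   ≤⟨ +-monoʳ-≤ (ℕtoℚ s) (<⇒≤ τ²n<x+1) ⟩
        ℕtoℚ s + ℕtoℚ (suc x)          ≡⟨ ℕtoℚ-+ s (suc x) ⟨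
        ℕtoℚ (s ℕ.+ suc x)             ≤⟨ ℕtoℚ-mono-≤ (ℕ.≤-trans (ℕ.≤-reflexive (ℕ.+-suc s x)) s+x<#R) ⟩
        ℕtoℚ (# R)                     ≤⟨ ℕtoℚ-mono-≤ (ℕ.≤-trans (#-mono R⊆RN⁺) (ℕ.≤-reflexive (sym (count≡# robust)))) ⟩
        ℕtoℚ Sub.∣ RN⁺ (τ * τ) G S ∣   ∎
      where
        open ≤-Reasoning
        s = Sub.∣ S ∣
        P = lookup S
        R : Fin n → Bool
        R v = does (x ℕ.<? degIn G P v)

        t<s : t ℕ.< # P
        t<s = subst (t ℕ.<_) (∣S∣≡# S) (ℕtoℚ-cancel-< (≤-<-trans t≤τn τn<s))

        t+s<n : t ℕ.+ # P ℕ.< n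
        t+s<n = subst (λ y → t ℕ.+ y ℕ.< n) (∣S∣≡# S) (ℕtoℚ-cancel-< (begin-strict
            ℕtoℚ (t ℕ.+ s)              ≡⟨ ℕtoℚ-+ t s ⟩
            ℕtoℚ t + ℕtoℚ s             <⟨ +-mono-≤-< t≤τn s<[1-τ]n ⟩
            τn + (1ℚ - τ) * ℕtoℚ n      ≡⟨ complement τ (ℕtoℚ n) ⟩
            ℕtoℚ n                      ∎))
          where
            open +-*-Solver
            complement : ∀ a m → a * m + (1ℚ - a) * m ≡ m
            complement = solve 2 (λ a m → a :* m :+ (con 1ℚ :- a) :* m := m) refl

        s+x<#R : s ℕ.+ x ℕ.< # R
        s+x<#R = subst (λ y → y ℕ.+ x ℕ.< # R) (sym (∣S∣≡# S))
          (expands G e t x t≥1 2x<t 4t≤e nx<[t+1]² (integer-degree-condition G dc) P t<s t+s<n)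

        robust : Fin n → Bool
        robust v = does (τ²n ≤? ℕtoℚ (inNbrsIn G S v))

        R⊆RN⁺ : ∀ v → T (R v) → T (robust v)
        R⊆RN⁺ v v∈R = ⇒does (τ²n ≤? ℕtoℚ (inNbrsIn G S v)) (<⇒≤ (<-≤-trans τ²n<x+1 (ℕtoℚ-mono-≤
          (subst (suc x ℕ.≤_) (sym (count≡# (λ u → P u ∧ adj G u v))) (does⇒ (x ℕ.<? degIn G P v) v∈R)))))


open import Defs
open import Data.Nat using (ℕ; _≥_; _+_)
import Data.Nat.Properties as ℕ
open import Data.Product using (Σ; _×_; _,_)
open import Data.Rational using (ℚ; 0ℚ; 1ℚ; _<_; _≤_; _*_)
open NaturalsInRationals using (archimedean)
open Thresholds using (¼; 0<η¼; 4τ≤η; min-semidegree; robust-expander)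

lemma13 : (η : ℚ) → 0ℚ < η → η < 1ℚ →
    Σ ℚ λ τ₀ → 0ℚ < τ₀ ×
      ((τ : ℚ) → 0ℚ < τ → τ ≤ τ₀ →
        Σ ℕ λ n₀ → (n : ℕ) → n ≥ n₀ → (G : Digraph n) →
          DegSeqCond η G →
          (η * ℕtoℚ n ≤ ℕtoℚ (δ⁰ G)) × RobustOutexpander (τ * τ) τ G)
lemma13 η 0<η η<1 = η * ¼ , 0<η¼ 0<η , λ τ 0<τ τ≤η¼ →
  let n₁ , τn≥1-eventually = archimedean τ 0<τ 1 in
  n₁ + 3 , λ n n≥n₁+3 G degSeqCond →
    let τn≥1 = τn≥1-eventually n (ℕ.m+n≤o⇒m≤o n₁ n≥n₁+3)
        n≥3  = ℕ.m+n≤o⇒n≤o n₁ n≥n₁+3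
    in min-semidegree η τ n 0<η 0<τ (4τ≤η τ≤η¼) η<1 τn≥1 G degSeqCond n≥3 ,
       robust-expander η τ n 0<η 0<τ (4τ≤η τ≤η¼) η<1 τn≥1 G degSeqCond
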